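{- Let $w$ be a permutation. The closed interval poset $\overline{\mathcal{P}}(w)$ is a modular lattice if and only if $w$ is a simple permutation.
   Context: For $w \in \mathfrak{S}_n$ in one-line notation $w(1)\cdots w(n)$, an interval of $w$ is a set of consecutive integers $[h,h+j]$ (possibly empty) with $\{w(t) : t \in [i,i+j]\} = [h,h+j]$ for some $i$. An interval is proper if it has between $2$ and $n-1$ elements; $w$ is simple if it has no proper intervals. $\mathcal{P}(w)$ is the set of nonempty intervals of $w$ ordered by inclusion, and $\overline{\mathcal{P}}(w)$ is $\mathcal{P}(w)$ with a minimum element $\widehat{0}$ (the empty interval) adjoined; it is a lattice. A lattice is modular if $a \le b$ implies $a \vee (x \wedge b) = (a \vee x) \wedge b$ for all $x$. -}

module Defs where

open import Data.Nat using (ℕ; _+_; _∸_; _≤_; _<_)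
open import Data.Fin using (Fin; toℕ)
open import Data.Fin.Permutation using (Permutation′; _⟨$⟩ʳ_)
open import Data.Maybe using (Maybe; just; nothing)
open import Data.Product using (Σ; ∃; _×_; _,_; proj₁)
open import Data.Unit using (⊤)
open import Data.Empty using (⊥)
open import Relation.Nullary using (¬_)
open import Relation.Binary.PropositionalEquality using (_≡_)

val : ∀ {n} → Permutation′ n → Fin n → ℕ
val w t = toℕ (w ⟨$⟩ʳ t)

-- [lo,hi] (values, 0-based) is a nonempty interval of w: lo ≤ hi and there is a
-- starting position i with {w(t) : t ∈ [i, i + (hi ∸ lo)]} = [lo, hi].
IsInterval : ∀ {n} → Permutation′ n → ℕ → ℕ → Set
IsInterval {n} w lo hi =
  lo ≤ hi ×
  Σ ℕ λ i → (i + (hi ∸ lo) < n) ×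
    ((∀ (t : Fin n) → i ≤ toℕ t → toℕ t ≤ i + (hi ∸ lo) →
        lo ≤ val w t × val w t ≤ hi) ×
     (∀ (v : ℕ) → lo ≤ v → v ≤ hi →
        Σ (Fin n) λ t → i ≤ toℕ t × toℕ t ≤ i + (hi ∸ lo) × val w t ≡ v))

size : ℕ → ℕ → ℕ
size lo hi = (hi ∸ lo) + 1

IsSimple : ∀ {n} → Permutation′ n → Set
IsSimple {n} w = ∀ lo hi → IsInterval w lo hi →
  ¬ (2 ≤ size lo hi × size lo hi ≤ n ∸ 1)

-- Elements of the closed interval poset: nothing = the adjoined minimum 0̂
-- (empty interval), just (lo , hi) = the nonempty interval [lo,hi].
Valid : ∀ {n} → Permutation′ n → Maybe (ℕ × ℕ) → Set
Valid w nothing = ⊤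
Valid w (just (lo , hi)) = IsInterval w lo hi

Elem : ∀ {n} → Permutation′ n → Set
Elem w = Σ (Maybe (ℕ × ℕ)) (Valid w)

_⊑_ : Maybe (ℕ × ℕ) → Maybe (ℕ × ℕ) → Set
nothing ⊑ _ = ⊤
just _ ⊑ nothing = ⊥
just (a , b) ⊑ just (c , d) = c ≤ a × b ≤ d

module _ {n} (w : Permutation′ n) where

  _≤P_ : Elem w → Elem w → Set
  x ≤P y = proj₁ x ⊑ proj₁ y

  IsMeet : Elem w → Elem w → Elem w → Set
  IsMeet x y m = m ≤P x × m ≤P y × (∀ z → z ≤P x → z ≤P y → z ≤P m)

  IsJoin : Elem w → Elem w → Elem w → Set
  IsJoin x y j = x ≤P j × y ≤P j × (∀ z → x ≤P z → y ≤P z → j ≤P z)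

  IsModularLattice : Set
  IsModularLattice =
    (∀ x y → ∃ λ m → IsMeet x y m) ×
    (∀ x y → ∃ λ j → IsJoin x y j) ×
    (∀ a b x → a ≤P b → ∀ m j₁ j₂ m₂ →
       IsMeet x b m → IsJoin a m j₁ → IsJoin a x j₂ → IsMeet j₂ b m₂ →
       proj₁ j₁ ≡ proj₁ m₂)

-- If w is simple, its only intervals are 0̂, the singletons and the whole of
-- [0, n-1], so P̄(w) has height at most two, and a lattice of height two is
-- modular: for a ≤ b either a = b, a = 0̂ or b is the top, and in each case the
-- modular law is immediate.  Conversely, let I be a proper interval occupying
-- positions [i, i+k], let p be the position at one end of this window and q the
-- position just beyond the other end.  Intervals are convex in positions, so an
-- interval containing w(p) and w(q) contains I; hence, with a = {w(p)} and
-- x = {w(q)}, we get x ∧ I = 0̂ and I ≤ a ∨ x.  The modular law then yields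
-- I = a ∨ (x ∧ I) = (a ∨ x) ∧ I = a ∨ 0̂ = a, contradicting |I| ≥ 2.
module Submission where

open import Defs
open import Data.Nat using (ℕ; zero; suc; pred; >-nonZero; _+_; _∸_; _≤_; _<_; z≤n; _≤?_; _<?_; _≟_)
open import Data.Nat.Properties
open import Data.Fin using (Fin; toℕ; fromℕ<)
open import Data.Fin.Properties using (toℕ-injective; toℕ<n; toℕ-fromℕ<)
open import Data.Fin.Permutation using (Permutation′; _⟨$⟩ˡ_; inverseˡ; inverseʳ)
open import Data.Maybe using (just; nothing)
open import Data.Product using (Σ; ∃; _×_; _,_; proj₁; proj₂)
open import Data.Sum using (_⊎_; inj₁; inj₂)
open import Data.Unit using (tt)
open import Data.Empty using (⊥; ⊥-elim)
open import Relation.Nullary using (¬_; Dec; yes; no)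
open import Relation.Binary.PropositionalEquality

infix 4 _∈[_,_]

_∈[_,_] : ℕ → ℕ → ℕ → Set
v ∈[ c , d ] = c ≤ v × v ≤ d

pred≡∸1 : ∀ n → pred n ≡ n ∸ 1
pred≡∸1 n = pred[m∸n]≡m∸[1+n] n 0

<⇒≤∸1 : ∀ {m n} → m < n → m ≤ n ∸ 1
<⇒≤∸1 {m} {n} m<n = subst (m ≤_) (pred≡∸1 n) (<⇒≤pred m<n)

2≤size⇒< : ∀ {lo hi} → 2 ≤ size lo hi → lo < hi
2≤size⇒< 2≤size = m∸n≢0⇒n<m λ k≡0 → 1+n≰n (subst (λ k → 2 ≤ k + 1) k≡0 2≤size)

window-neighbour : ∀ {n} i k → k + 1 ≤ n ∸ 1 → suc (i + k) < n ⊎ Σ ℕ λ i′ → i ≡ suc i′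
window-neighbour {n} i k small with suc (i + k) <? n
window-neighbour i        k small | yes room = inj₁ room
window-neighbour (suc i′) k small | no _     = inj₂ (i′ , refl)
window-neighbour zero     k small | no full  =
  ⊥-elim (m+1+n≰m k (≤-trans small (∸-monoˡ-≤ 1 (≮⇒≥ full))))

⊑-refl : ∀ x → x ⊑ x
⊑-refl nothing        = tt
⊑-refl (just (a , b)) = ≤-refl , ≤-refl

⊑-trans : ∀ x y z → x ⊑ y → y ⊑ z → x ⊑ z
⊑-trans nothing        _              _              _       _       = tt
⊑-trans (just _)       nothing        _              ()      _
⊑-trans (just _)       (just _)       nothing        _       ()
⊑-trans (just _)       (just _)       (just _)       (p , q) (r , s) = ≤-trans r p , ≤-trans q s

⊑-antisym : ∀ x y → x ⊑ y → y ⊑ x → x ≡ y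
⊑-antisym nothing  nothing  _       _       = refl
⊑-antisym nothing  (just _) _       ()
⊑-antisym (just _) nothing  ()      _
⊑-antisym (just _) (just _) (p , q) (r , s) =
  cong₂ (λ u v → just (u , v)) (≤-antisym r p) (≤-antisym q s)

_⊑?_ : ∀ x y → Dec (x ⊑ y)
nothing      ⊑? _            = yes tt
just _       ⊑? nothing      = no λ ()
just (a , b) ⊑? just (c , d) with c ≤? a | b ≤? d
... | yes p | yes q = yes (p , q)
... | no ¬p | _     = no λ r → ¬p (proj₁ r)
... | _     | no ¬q = no λ r → ¬q (proj₂ r)

⊑-singleton⇒⊒ : ∀ {a b e} → a ≤ b → just (a , b) ⊑ just (e , e) → just (e , e) ⊑ just (a , b)
⊑-singleton⇒⊒ a≤b (e≤a , b≤e) = ≤-trans a≤b b≤e , ≤-trans e≤a a≤b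

module _ {n : ℕ} {w : Permutation′ n} where

  infix 4 _≼_

  _≼_ : Elem w → Elem w → Set
  _≼_ = _≤P_ w

  ModularAt : Elem w → Elem w → Elem w → Set
  ModularAt a b x = ∀ m j₁ j₂ m₂ →
    IsMeet w x b m → IsJoin w a m j₁ → IsJoin w a x j₂ → IsMeet w j₂ b m₂ →
    proj₁ j₁ ≡ proj₁ m₂

  meet-of-≼ : ∀ x y m → IsMeet w x y m → x ≼ y → proj₁ m ≡ proj₁ x
  meet-of-≼ x y m (m≼x , _ , glb) x≼y = ⊑-antisym _ _ m≼x (glb x (⊑-refl _) x≼y)

  meet-of-≽ : ∀ x y m → IsMeet w x y m → y ≼ x → proj₁ m ≡ proj₁ y
  meet-of-≽ x y m (_ , m≼y , glb) y≼x = ⊑-antisym _ _ m≼y (glb y y≼x (⊑-refl _))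

  join-of-≼ : ∀ x y j → IsJoin w x y j → x ≼ y → proj₁ j ≡ proj₁ y
  join-of-≼ x y j (_ , y≼j , lub) x≼y = ⊑-antisym _ _ (lub y x≼y (⊑-refl _)) y≼j

  join-of-≽ : ∀ x y j → IsJoin w x y j → y ≼ x → proj₁ j ≡ proj₁ x
  join-of-≽ x y j (x≼j , _ , lub) y≼x = ⊑-antisym _ _ (lub x (⊑-refl _) y≼x) x≼j

  meet-cong : ∀ x y m x′ y′ m′ → IsMeet w x y m → IsMeet w x′ y′ m′ →
    proj₁ x ≡ proj₁ x′ → proj₁ y ≡ proj₁ y′ → proj₁ m ≡ proj₁ m′
  meet-cong _ _ m _ _ m′ (m≼x , m≼y , glb) (m′≼x′ , m′≼y′ , glb′) refl refl =
    ⊑-antisym _ _ (glb′ m m≼x m≼y) (glb m′ m′≼x′ m′≼y′)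

  join-cong : ∀ x y j x′ y′ j′ → IsJoin w x y j → IsJoin w x′ y′ j′ →
    proj₁ x ≡ proj₁ x′ → proj₁ y ≡ proj₁ y′ → proj₁ j ≡ proj₁ j′
  join-cong _ _ j _ _ j′ (x≼j , y≼j , lub) (x′≼j′ , y′≼j′ , lub′) refl refl =
    ⊑-antisym _ _ (lub j′ x′≼j′ y′≼j′) (lub′ j x≼j y≼j)

  modularAt-≡ : ∀ a b x → proj₁ a ≡ proj₁ b → ModularAt a b x
  modularAt-≡ a b x a≡b m j₁ j₂ m₂ M₁ J₁ J₂ M₂ = begin
    proj₁ j₁ ≡⟨ join-of-≽ a m j₁ J₁ (subst (proj₁ m ⊑_) (sym a≡b) (proj₁ (proj₂ M₁))) ⟩
    proj₁ a  ≡⟨ a≡b ⟩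
    proj₁ b  ≡⟨ sym (meet-of-≽ j₂ b m₂ M₂ (subst (_⊑ proj₁ j₂) a≡b (proj₁ J₂))) ⟩
    proj₁ m₂ ∎
    where open ≡-Reasoning

  modularAt-0̂ : ∀ a b x → proj₁ a ≡ nothing → ModularAt a b x
  modularAt-0̂ a b x a≡0̂ m j₁ j₂ m₂ M₁ J₁ J₂ M₂ =
    trans (join-of-≼ a m j₁ J₁ (a≼ m))
          (sym (meet-cong j₂ b m₂ x b m M₂ M₁ (join-of-≼ a x j₂ J₂ (a≼ x)) refl))
    where
    a≼ : ∀ z → a ≼ z
    a≼ _ rewrite a≡0̂ = tt

  modularAt-top : ∀ a b x → (∀ z → z ≼ b) → ModularAt a b x
  modularAt-top a b x top m j₁ j₂ m₂ M₁ J₁ J₂ M₂ =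
    trans (join-cong a m j₁ a x j₂ J₁ J₂ refl (meet-of-≼ x b m M₁ (top x)))
          (sym (meet-of-≼ j₂ b m₂ M₂ (top j₂)))

  -- b = (a ∨ x) ∧ b = a ∨ (x ∧ b) = a ∨ 0̂ = a.
  modular-collapse : IsModularLattice w → ∀ a b x → a ≼ b →
    (∀ z → z ≼ x → z ≼ b → proj₁ z ⊑ nothing) → (∀ z → a ≼ z → x ≼ z → b ≼ z) → b ≼ a
  modular-collapse (meets , joins , law) a b x a≼b disjoint spanning =
    ⊑-trans _ _ _ b≼m₂ (subst (_⊑ proj₁ a) (law a b x a≼b m j₁ j₂ m₂ M₁ J₁ J₂ M₂) j₁≼a)
    where
    m  = proj₁ (meets x b)
    M₁ = proj₂ (meets x b)
    j₁ = proj₁ (joins a m)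
    J₁ = proj₂ (joins a m)
    j₂ = proj₁ (joins a x)
    J₂ = proj₂ (joins a x)
    m₂ = proj₁ (meets j₂ b)
    M₂ = proj₂ (meets j₂ b)
    j₁≼a : j₁ ≼ a
    j₁≼a = proj₂ (proj₂ J₁) a (⊑-refl _)
      (⊑-trans _ nothing _ (disjoint m (proj₁ M₁) (proj₁ (proj₂ M₁))) tt)
    b≼m₂ : b ≼ m₂
    b≼m₂ = proj₂ (proj₂ M₂) b (spanning j₂ (proj₁ J₂) (proj₁ (proj₂ J₂))) (⊑-refl _)

module _ {n : ℕ} (w : Permutation′ n) where

  val-injective : ∀ {t t′} → val w t ≡ val w t′ → t ≡ t′
  val-injective e = trans (sym (inverseˡ w)) (trans (cong (w ⟨$⟩ˡ_) (toℕ-injective e)) (inverseˡ w))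

  start : ∀ {c d} → IsInterval w c d → ℕ
  start I = proj₁ (proj₂ I)

  end : ∀ {c d} → IsInterval w c d → ℕ
  end {c} {d} I = start I + (d ∸ c)

  end<n : ∀ {c d} (I : IsInterval w c d) → end I < n
  end<n I = proj₁ (proj₂ (proj₂ I))

  start<n : ∀ {c d} (I : IsInterval w c d) → start I < n
  start<n I = ≤-<-trans (m≤m+n _ _) (end<n I)

  interval-values : ∀ {c d} (I : IsInterval w c d) (t : Fin n) →
    toℕ t ∈[ start I , end I ] → val w t ∈[ c , d ]
  interval-values (_ , _ , _ , values , _) t (i≤t , t≤end) = values t i≤t t≤end

  interval-positions : ∀ {c d} (I : IsInterval w c d) (t : Fin n) →
    val w t ∈[ c , d ] → toℕ t ∈[ start I , end I ]
  interval-positions (_ , _ , _ , _ , onto) t v∈ with onto (val w t) (proj₁ v∈) (proj₂ v∈)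
  ... | t′ , i≤t′ , t′≤end , same-value with val-injective {t′} {t} same-value
  ... | refl = i≤t′ , t′≤end

  interval-convex : ∀ {c d} (I : IsInterval w c d) {s u} (t : Fin n) →
    val w s ∈[ c , d ] → val w u ∈[ c , d ] → toℕ s ≤ toℕ t → toℕ t ≤ toℕ u → val w t ∈[ c , d ]
  interval-convex I {s} {u} t s∈ u∈ s≤t t≤u = interval-values I t
    (≤-trans (proj₁ (interval-positions I s s∈)) s≤t , ≤-trans t≤u (proj₂ (interval-positions I u u∈)))

  interval-hi<n : ∀ {c d} → IsInterval w c d → d < n
  interval-hi<n (c≤d , _ , _ , _ , onto) with onto _ c≤d ≤-refl
  ... | t , _ , _ , refl = toℕ<n _

  interval-spanning : ∀ {lo hi} (I : IsInterval w lo hi) {s u : Fin n} →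
    toℕ s ≤ start I → end I ≤ toℕ u → ∀ {c d} → IsInterval w c d →
    val w s ∈[ c , d ] → val w u ∈[ c , d ] → just (lo , hi) ⊑ just (c , d)
  interval-spanning I@(lo≤hi , _ , _ , _ , onto) s≤i end≤u J s∈ u∈ =
    proj₁ (contains _ (≤-refl , lo≤hi)) , proj₂ (contains _ (lo≤hi , ≤-refl))
    where
    contains : ∀ v → v ∈[ _ , _ ] → v ∈[ _ , _ ]
    contains v (lo≤v , v≤hi) with onto v lo≤v v≤hi
    ... | t , i≤t , t≤end , refl = interval-convex J t s∈ u∈ (≤-trans s≤i i≤t) (≤-trans t≤end end≤u)

  singleton-interval : (t : Fin n) → IsInterval w (val w t) (val w t)
  singleton-interval t =
    ≤-refl , toℕ t , subst (_< n) (sym t+0) (toℕ<n t) ,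
    (λ t′ t≤t′ t′≤t → ≤-reflexive (cong (val w) (same t′ t≤t′ t′≤t)) ,
                      ≤-reflexive (cong (val w) (sym (same t′ t≤t′ t′≤t)))) ,
    (λ v v≥ v≤ → t , ≤-refl , ≤-reflexive (sym t+0) , ≤-antisym v≥ v≤)
    where
    t+0 : toℕ t + (val w t ∸ val w t) ≡ toℕ t
    t+0 = trans (cong (toℕ t +_) (n∸n≡0 (val w t))) (+-identityʳ (toℕ t))
    same : ∀ t′ → toℕ t ≤ toℕ t′ → toℕ t′ ≤ toℕ t + (val w t ∸ val w t) → t ≡ t′
    same t′ t≤t′ t′≤t = toℕ-injective (≤-antisym t≤t′ (subst (toℕ t′ ≤_) t+0 t′≤t))

  singleton : Fin n → Elem w
  singleton t = just (val w t , val w t) , singleton-interval t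

  full-interval : 0 < n → IsInterval w 0 (n ∸ 1)
  full-interval 0<n =
    z≤n , 0 , n∸1<n , (λ t _ _ → z≤n , <⇒≤∸1 (toℕ<n _)) ,
    λ v _ v≤ → let t = fromℕ< (≤∸1⇒< v≤) in
      w ⟨$⟩ˡ t , z≤n , <⇒≤∸1 (toℕ<n _) ,
      trans (cong toℕ (inverseʳ w)) (toℕ-fromℕ< (≤∸1⇒< v≤))
    where
    ≤∸1⇒< : ∀ {m} → m ≤ n ∸ 1 → m < n
    ≤∸1⇒< {m} m≤ = m≤pred[n]⇒suc[m]≤n {{>-nonZero 0<n}} (subst (m ≤_) (sym (pred≡∸1 n)) m≤)
    n∸1<n : 0 + (n ∸ 1 ∸ 0) < n
    n∸1<n = ≤∸1⇒< ≤-refl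

  top : ∀ {c d} → IsInterval w c d → Elem w
  top I = just (0 , n ∸ 1) , full-interval (≤-<-trans z≤n (end<n I))

  ⊑-full : ∀ (z : Elem w) → proj₁ z ⊑ just (0 , n ∸ 1)
  ⊑-full (nothing , _) = tt
  ⊑-full (just _ , Z)  = z≤n , <⇒≤∸1 (interval-hi<n Z)

  modular⇒no-escaping-pair : IsModularLattice w → ∀ {lo hi} (I : IsInterval w lo hi) → lo < hi →
    (p q : Fin n) → toℕ p ∈[ start I , end I ] → ¬ toℕ q ∈[ start I , end I ] →
    (∀ {c d} → IsInterval w c d → val w p ∈[ c , d ] → val w q ∈[ c , d ] →
      just (lo , hi) ⊑ just (c , d)) →
    ⊥
  modular⇒no-escaping-pair ML {lo} {hi} I lo<hi p q p-in q-out spans =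
    <⇒≱ lo<hi (≤-trans (proj₂ I≼p) (proj₁ I≼p))
    where
    b : Elem w
    b = just (lo , hi) , I
    disjoint : ∀ z → z ≼ singleton q → z ≼ b → proj₁ z ⊑ nothing
    disjoint (nothing , _) _ _ = tt
    disjoint (just _ , (c≤d , _)) (q≤c , d≤q) (lo≤c , d≤hi) = q-out (interval-positions I q
      (≤-trans lo≤c (≤-trans c≤d d≤q) , ≤-trans q≤c (≤-trans c≤d d≤hi)))
    spanning : ∀ z → singleton p ≼ z → singleton q ≼ z → b ≼ z
    spanning (nothing , _)  ()
    spanning (just _ , J) p∈ q∈ = spans J p∈ q∈
    I≼p : b ≼ singleton p
    I≼p = modular-collapse ML (singleton p) b (singleton q) (interval-values I p p-in) disjoint spanning

  modular⇒simple : IsModularLattice w → IsSimple w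
  modular⇒simple ML lo hi I (2≤size , size≤) with window-neighbour (start I) (hi ∸ lo) size≤
  ... | inj₁ room = modular⇒no-escaping-pair ML I (2≤size⇒< 2≤size) p q
    (≤-reflexive (sym p≡start) , subst (_≤ end I) (sym p≡start) (m≤m+n _ _))
    (λ (_ , q≤end) → 1+n≰n (subst (_≤ end I) q≡end+1 q≤end))
    (interval-spanning I (≤-reflexive p≡start) (subst (end I ≤_) (sym q≡end+1) (n≤1+n _)))
    where
    p = fromℕ< (start<n I)
    q = fromℕ< room
    p≡start = toℕ-fromℕ< (start<n I)
    q≡end+1 = toℕ-fromℕ< room
  ... | inj₂ (i′ , start≡1+i′) = modular⇒no-escaping-pair ML I (2≤size⇒< 2≤size) p q
    (subst (start I ≤_) (sym p≡end) (m≤m+n _ _) , ≤-reflexive p≡end)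
    (λ (start≤q , _) → 1+n≰n (subst₂ _≤_ start≡1+i′ q≡i′ start≤q))
    (λ J p∈ q∈ → interval-spanning I q≤start (≤-reflexive (sym p≡end)) J q∈ p∈)
    where
    i′<n = <-trans (subst (i′ <_) (sym start≡1+i′) ≤-refl) (start<n I)
    p = fromℕ< (end<n I)
    q = fromℕ< i′<n
    p≡end = toℕ-fromℕ< (end<n I)
    q≡i′ = toℕ-fromℕ< i′<n
    q≤start = subst₂ _≤_ (sym q≡i′) (sym start≡1+i′) (n≤1+n i′)

module _ {n : ℕ} {w : Permutation′ n} (simple : IsSimple w) where

  large-interval-is-top : ∀ {c d} → IsInterval w c d → n ∸ 1 ≤ d ∸ c →
    ∀ (z : Elem w) → proj₁ z ⊑ just (c , d)
  large-interval-is-top {c} {d} J@(c≤d , _) large z =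
    ⊑-trans (proj₁ z) _ _ (⊑-full w z) (≤-trans c≤0 z≤n , ≤-trans large (m∸n≤m d c))
    where
    c≤0 : c ≤ 0
    c≤0 = ∸-cancelʳ-≤ c≤d (≤-trans (<⇒≤∸1 (interval-hi<n w J)) large)

  simple⇒singleton⊎top : ∀ {c d} → IsInterval w c d →
    c ≡ d ⊎ (∀ (z : Elem w) → proj₁ z ⊑ just (c , d))
  simple⇒singleton⊎top {c} {d} J@(c≤d , _) with d ∸ c ≟ 0 | size c d ≤? n ∸ 1
  ... | yes k≡0 | _        = inj₁ (≤-antisym c≤d (m∸n≡0⇒m≤n k≡0))
  ... | no  k≢0 | yes small = ⊥-elim (simple c d J (+-monoˡ-≤ 1 (n≢0⇒n>0 k≢0) , small))
  ... | no  _   | no  large =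
    inj₂ (large-interval-is-top J
      (+-cancelʳ-≤ 1 _ _ (subst (_≤ size c d) (+-comm 1 (n ∸ 1)) (≰⇒> large))))

  incomparable⇒meet-0̂ : ∀ (x y z : Elem w) → ¬ x ≼ y → ¬ y ≼ x → z ≼ x → z ≼ y → proj₁ z ⊑ nothing
  incomparable⇒meet-0̂ _ _ (nothing , _) _ _ _ _ = tt
  incomparable⇒meet-0̂ (nothing , _) _ (just _ , _) x⋠y _ _ _ = x⋠y tt
  incomparable⇒meet-0̂ x@(just _ , X) y z@(just _ , (c≤d , _)) x⋠y y⋠x z≼x z≼y
    with simple⇒singleton⊎top X
  ... | inj₁ refl  = x⋠y (⊑-trans (proj₁ x) (proj₁ z) (proj₁ y) (⊑-singleton⇒⊒ c≤d z≼x) z≼y)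
  ... | inj₂ x-top = y⋠x (x-top y)

  incomparable⇒join-top : ∀ (x y z : Elem w) → ¬ x ≼ y → ¬ y ≼ x → x ≼ z → y ≼ z → ∀ u → u ≼ z
  incomparable⇒join-top (nothing , _) _ _ x⋠y _ _ _ = ⊥-elim (x⋠y tt)
  incomparable⇒join-top (just _ , _) _ (nothing , _) _ _ () _
  incomparable⇒join-top (just _ , _) (nothing , _) (just _ , _) _ y⋠x _ _ = ⊥-elim (y⋠x tt)
  incomparable⇒join-top x@(just _ , _) y@(just _ , (c≤d , _)) z@(just _ , Z) x⋠y _ x≼z y≼z
    with simple⇒singleton⊎top Z
  ... | inj₁ refl  = ⊥-elim (x⋠y (⊑-trans (proj₁ x) (proj₁ z) (proj₁ y) x≼z (⊑-singleton⇒⊒ c≤d y≼z)))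
  ... | inj₂ z-top = z-top

  meet : ∀ (x y : Elem w) → ∃ λ m → IsMeet w x y m
  meet x y with proj₁ x ⊑? proj₁ y | proj₁ y ⊑? proj₁ x
  ... | yes x≼y | _       = x , ⊑-refl _ , x≼y , λ _ z≼x _ → z≼x
  ... | no _    | yes y≼x = y , y≼x , ⊑-refl _ , λ _ _ z≼y → z≼y
  ... | no x⋠y  | no y⋠x  =
    (nothing , tt) , tt , tt , λ z → incomparable⇒meet-0̂ x y z x⋠y y⋠x

  join : ∀ (x y : Elem w) → ∃ λ j → IsJoin w x y j
  join (nothing , _) y = y , tt , ⊑-refl _ , λ _ _ y≼z → y≼z
  join x@(just _ , X) y with proj₁ x ⊑? proj₁ y | proj₁ y ⊑? proj₁ x
  ... | yes x≼y | _       = y , x≼y , ⊑-refl _ , λ _ _ y≼z → y≼z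
  ... | no _    | yes y≼x = x , ⊑-refl _ , y≼x , λ _ x≼z _ → x≼z
  ... | no x⋠y  | no y⋠x  = top w X , ⊑-full w x , ⊑-full w y ,
    λ z x≼z y≼z → incomparable⇒join-top x y z x⋠y y⋠x x≼z y≼z (top w X)

  modular : ∀ (a b x : Elem w) → a ≼ b → ModularAt a b x
  modular a@(nothing , _) b x _ = modularAt-0̂ a b x refl
  modular (just _ , _) (nothing , _) x ()
  modular a@(just _ , (c≤d , _)) b@(just _ , B) x a≼b with simple⇒singleton⊎top B
  ... | inj₁ refl  = modularAt-≡ a b x (⊑-antisym _ _ a≼b (⊑-singleton⇒⊒ c≤d a≼b))
  ... | inj₂ b-top = modularAt-top a b x b-top

  simple⇒modular : IsModularLattice w
  simple⇒modular = meet , join , modular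

theorem3p5 : ∀ (n : ℕ) (w : Permutation′ n) →
    (IsModularLattice w → IsSimple w) × (IsSimple w → IsModularLattice w)
theorem3p5 n w = modular⇒simple w , simple⇒modular
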